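{- Let $k\in\mathbb{N}$ and let $a\in N(k)$ be a compact element. Then there is $n_a\in\mathbb{N}$ such that $a\sqsubseteq a_n$ for all $n\ge n_a$.
   Context: $N(0)=\mathbb{N}_\bot$ is the flat domain over $\mathbb{N}=\{0,1,\dots\}$ and $N(k+1)=N(k)\to N(0)$ is the Scott domain of Scott-continuous maps, ordered pointwise. For $a\in N(k)$ and $n\in\mathbb{N}$ the $n$-th approximation $a_n$ is defined by recursion on $k$: for $k=0$, $\bot_n=\bot$, and for $a\in\mathbb{N}$, $a_n=a$ if $a\le n$ and $a_n=0$ if $n<a$; for $k>0$, $a_n(x)=(a(x_n))_n$ for $x\in N(k-1)$. -}

module Defs where

open import Data.Nat using (ℕ; zero; suc; _≤?_)
open import Data.Product using (Σ; _×_; _,_; proj₁; proj₂; Σ-syntax)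
open import Data.Sum using (_⊎_; inj₁; inj₂)
open import Data.Empty using (⊥; ⊥-elim)
open import Relation.Nullary using (¬_; yes; no)
open import Relation.Binary.PropositionalEquality using (_≡_; refl; sym; trans; subst)
open import Function using (_∘_)

-- Classical logic (the paper's ambient metatheory); needed to show that
-- the approximation maps a ↦ a_n land in the Scott domains N(k).
LEM : Set₂
LEM = (P : Set₁) → P ⊎ ¬ P

data ℕ⊥ : Set₁ where
  ⊥ₙ  : ℕ⊥
  ⟨_⟩ : ℕ → ℕ⊥

data _⊑₀_ : ℕ⊥ → ℕ⊥ → Set₁ where
  ⊥⊑  : ∀ {x} → ⊥ₙ ⊑₀ x
  ⟨⟩⊑ : ∀ {m} → ⟨ m ⟩ ⊑₀ ⟨ m ⟩

⊑₀-trans : ∀ {x y z} → x ⊑₀ y → y ⊑₀ z → x ⊑₀ z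
⊑₀-trans ⊥⊑ _ = ⊥⊑
⊑₀-trans ⟨⟩⊑ q = q

⊑₀-refl : ∀ x → x ⊑₀ x
⊑₀-refl ⊥ₙ = ⊥⊑
⊑₀-refl ⟨ m ⟩ = ⟨⟩⊑

⟨⟩⊑-inv : ∀ {c x} → ⟨ c ⟩ ⊑₀ x → x ≡ ⟨ c ⟩
⟨⟩⊑-inv ⟨⟩⊑ = refl

⟨⟩-inj : ∀ {a b} → ⟨ a ⟩ ≡ ⟨ b ⟩ → a ≡ b
⟨⟩-inj refl = refl

noBot : ∀ {m} → ¬ (⟨ m ⟩ ⊑₀ ⊥ₙ)
noBot ()

to⊑ : ∀ {x c} → ((c₁ : ℕ) → x ≡ ⟨ c₁ ⟩ → c₁ ≡ c) → x ⊑₀ ⟨ c ⟩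
to⊑ {⊥ₙ} _ = ⊥⊑
to⊑ {⟨ c₁ ⟩} f with f c₁ refl
... | refl = ⟨⟩⊑

to⊥ : ∀ {x} → ((c₁ : ℕ) → x ≡ ⟨ c₁ ⟩ → ⊥) → x ⊑₀ ⊥ₙ
to⊥ {⊥ₙ} _ = ⊥⊑
to⊥ {⟨ c₁ ⟩} f = ⊥-elim (f c₁ refl)

⊑⟨⟩ : ∀ {x c} → x ⊑₀ ⟨ c ⟩ → (x ≡ ⊥ₙ) ⊎ (x ≡ ⟨ c ⟩)
⊑⟨⟩ ⊥⊑ = inj₁ refl
⊑⟨⟩ ⟨⟩⊑ = inj₂ refl

-- Directed families and least upper bounds w.r.t. a preorder
-- (directed sets are given as families indexed by a type I : Set)

module _ {A : Set₁} (_≤_ : A → A → Set₁) where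
  IsDirected : {I : Set} → (I → A) → Set₁
  IsDirected {I} d = I × ((i j : I) → Σ[ l ∈ I ] ((d i ≤ d l) × (d j ≤ d l)))

  IsLub : {I : Set} → (I → A) → A → Set₁
  IsLub {I} d s = ((i : I) → d i ≤ s) × ((u : A) → ((i : I) → d i ≤ u) → s ≤ u)

dir-map : {A B : Set₁} (_≤A_ : A → A → Set₁) (_≤B_ : B → B → Set₁) (f : A → B) →
          ((x y : A) → x ≤A y → f x ≤B f y) →
          {I : Set} {d : I → A} → IsDirected _≤A_ d → IsDirected _≤B_ (f ∘ d)
dir-map _ _ f m (i₀ , h) = i₀ , λ i j → proj₁ (h i j) , m _ _ (proj₁ (proj₂ (h i j))) , m _ _ (proj₂ (proj₂ (h i j)))

mutual
  N : ℕ → Set₁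
  N zero = ℕ⊥
  N (suc k) = Σ (N k → ℕ⊥) (IsScottContinuous k)

  Leq : (k : ℕ) → N k → N k → Set₁
  Leq zero x y = x ⊑₀ y
  Leq (suc k) f g = (x : N k) → proj₁ f x ⊑₀ proj₁ g x

  IsScottContinuous : (k : ℕ) → (N k → ℕ⊥) → Set₁
  IsScottContinuous k f =
    ((x y : N k) → Leq k x y → f x ⊑₀ f y) ×
    ({I : Set} (d : I → N k) (s : N k) →
       IsDirected (Leq k) d → IsLub (Leq k) d s → IsLub _⊑₀_ (f ∘ d) (f s))

IsCompact : (k : ℕ) → N k → Set₁
IsCompact k a =
  {I : Set} (d : I → N k) (s : N k) →
  IsDirected (Leq k) d → IsLub (Leq k) d s → Leq k a s → Σ[ i ∈ I ] Leq k a (d i)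

approx₀ : ℕ → ℕ⊥ → ℕ⊥
approx₀ n ⊥ₙ = ⊥ₙ
approx₀ n ⟨ m ⟩ with m ≤? n
... | yes _ = ⟨ m ⟩
... | no _ = ⟨ 0 ⟩

approx₀-mono : ∀ n {x y} → x ⊑₀ y → approx₀ n x ⊑₀ approx₀ n y
approx₀-mono n ⊥⊑ = ⊥⊑
approx₀-mono n (⟨⟩⊑ {m}) = ⊑₀-refl (approx₀ n ⟨ m ⟩)

module Classical (lem : LEM) where

  flat-witness : {I : Set} (e : I → ℕ⊥) (c : ℕ) → IsLub _⊑₀_ e ⟨ c ⟩ → Σ[ j ∈ I ] (e j ≡ ⟨ c ⟩)
  flat-witness {I} e c (ub , least) with lem (Σ[ j ∈ I ] (e j ≡ ⟨ c ⟩))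
  ... | inj₁ w = w
  ... | inj₂ nw = ⊥-elim (noBot (least ⊥ₙ bnd))
    where
    bnd : (j : I) → e j ⊑₀ ⊥ₙ
    bnd j with ⊑⟨⟩ (ub j)
    ... | inj₁ eq = subst (λ z → z ⊑₀ ⊥ₙ) (sym eq) ⊥⊑
    ... | inj₂ eq = ⊥-elim (nw (j , eq))

  approx₀-lub : (n : ℕ) {I : Set} (e : I → ℕ⊥) (t : ℕ⊥) → IsLub _⊑₀_ e t →
                IsLub _⊑₀_ (approx₀ n ∘ e) (approx₀ n t)
  approx₀-lub n e ⊥ₙ lub = (λ i → approx₀-mono n (proj₁ lub i)) , λ u _ → ⊥⊑
  approx₀-lub n e ⟨ c ⟩ lub with flat-witness e c lub
  ... | j , eq = (λ i → approx₀-mono n (proj₁ lub i)) ,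
                 λ u h → subst (λ z → approx₀ n z ⊑₀ u) eq (h j)

  module PW {k : ℕ} {I : Set} (d : I → N (suc k)) (dir : IsDirected (Leq (suc k)) d) where
    P : N k → Set₁
    P z = Σ[ i ∈ I ] Σ[ c ∈ ℕ ] (proj₁ (d i) z ≡ ⟨ c ⟩)

    pick : {z : N k} → P z ⊎ ¬ P z → ℕ⊥
    pick (inj₁ (_ , c , _)) = ⟨ c ⟩
    pick (inj₂ _) = ⊥ₙ

    wf : N k → ℕ⊥
    wf z = pick (lem (P z))

    agree : ∀ z i j c c' → proj₁ (d i) z ≡ ⟨ c ⟩ → proj₁ (d j) z ≡ ⟨ c' ⟩ → c ≡ c'
    agree z i j c c' e1 e2 =
      let l = proj₁ (proj₂ dir i j)
          p = proj₁ (proj₂ (proj₂ dir i j))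
          q = proj₂ (proj₂ (proj₂ dir i j))
      in ⟨⟩-inj (trans (sym (⟨⟩⊑-inv (subst (λ v → v ⊑₀ proj₁ (d l) z) e1 (p z))))
                       (⟨⟩⊑-inv (subst (λ v → v ⊑₀ proj₁ (d l) z) e2 (q z))))

    wf-ub : ∀ i z → proj₁ (d i) z ⊑₀ wf z
    wf-ub i z with lem (P z)
    ... | inj₁ (j , c' , e') = to⊑ (λ c₁ e → agree z i j c₁ c' e e')
    ... | inj₂ np = to⊥ (λ c₁ e → np (i , c₁ , e))

    wf-mono : (x y : N k) → Leq k x y → wf x ⊑₀ wf y
    wf-mono x y p with lem (P x)
    ... | inj₂ _ = ⊥⊑
    ... | inj₁ (i , c , e) =
      ⊑₀-trans (subst (λ v → v ⊑₀ proj₁ (d i) y) e (proj₁ (proj₂ (d i)) x y p)) (wf-ub i y)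

    wf-lub : {J : Set} (e : J → N k) (t : N k) → IsDirected (Leq k) e → IsLub (Leq k) e t →
             IsLub _⊑₀_ (wf ∘ e) (wf t)
    wf-lub {J} e t de le = (λ j → wf-mono (e j) t (proj₁ le j)) , least
      where
      least : (u : ℕ⊥) → ((j : J) → wf (e j) ⊑₀ u) → wf t ⊑₀ u
      least u h with lem (P t)
      ... | inj₂ _ = ⊥⊑
      ... | inj₁ (i , c , eq)
        with flat-witness (proj₁ (d i) ∘ e) c
               (subst (IsLub _⊑₀_ (proj₁ (d i) ∘ e)) eq (proj₂ (proj₂ (d i)) e t de le))
      ... | j , eqj = ⊑₀-trans (subst (λ v → v ⊑₀ wf (e j)) eqj (wf-ub i (e j))) (h j)

    w : N (suc k)
    w = wf , wf-mono , wf-lub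

    wf-hit : ∀ y m → ⟨ m ⟩ ⊑₀ wf y → Σ[ i ∈ I ] (proj₁ (d i) y ≡ ⟨ m ⟩)
    wf-hit y m p with lem (P y)
    ... | inj₁ (i , c , e) = i , trans e (⟨⟩⊑-inv p)
    ... | inj₂ _ = ⊥-elim (noBot p)

    pointwise : (s : N (suc k)) → IsLub (Leq (suc k)) d s → (y : N k) →
                IsLub _⊑₀_ (λ i → proj₁ (d i) y) (proj₁ s y)
    pointwise s (ub , least) y = (λ i → ub i y) , lst
      where
      lst : (v : ℕ⊥) → ((i : I) → proj₁ (d i) y ⊑₀ v) → proj₁ s y ⊑₀ v
      lst v h with proj₁ s y in eqs
      ... | ⊥ₙ = ⊥⊑
      ... | ⟨ m ⟩ with lem (Σ[ i ∈ I ] (proj₁ (d i) y ≡ ⟨ m ⟩))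
      ...   | inj₁ (i , e) = subst (λ z → z ⊑₀ v) e (h i)
      ...   | inj₂ ne = ⊥-elim (ne (wf-hit y m
                 (subst (λ z → z ⊑₀ wf y) eqs (least w (λ i → wf-ub i) y))))

  mutual
    approx : (k n : ℕ) → N k → N k
    approx zero n x = approx₀ n x
    approx (suc k) n (f , fc) = (λ x → approx₀ n (f (approx k n x))) , mono' , lub'
      where
      mono' : (x y : N k) → Leq k x y → approx₀ n (f (approx k n x)) ⊑₀ approx₀ n (f (approx k n y))
      mono' x y p = approx₀-mono n (proj₁ fc _ _ (approx-mono k n x y p))

      lub' : {I : Set} (d : I → N k) (s : N k) → IsDirected (Leq k) d → IsLub (Leq k) d s →
             IsLub _⊑₀_ (λ i → approx₀ n (f (approx k n (d i)))) (approx₀ n (f (approx k n s)))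
      lub' d s dd ls =
        approx₀-lub n (λ i → f (approx k n (d i))) (f (approx k n s))
          (proj₂ fc (λ i → approx k n (d i)) (approx k n s)
             (dir-map (Leq k) (Leq k) (approx k n) (approx-mono k n) dd)
             (approx-lub k n d s dd ls))

    approx-mono : (k n : ℕ) (x y : N k) → Leq k x y → Leq k (approx k n x) (approx k n y)
    approx-mono zero n x y p = approx₀-mono n p
    approx-mono (suc k) n f g p x = approx₀-mono n (p (approx k n x))

    approx-lub : (k n : ℕ) {I : Set} (d : I → N k) (s : N k) → IsDirected (Leq k) d →
                 IsLub (Leq k) d s → IsLub (Leq k) (λ i → approx k n (d i)) (approx k n s)
    approx-lub zero n d s dd ls = approx₀-lub n d s ls
    approx-lub (suc k) n {I} d s dd ls = (λ i → approx-mono (suc k) n (d i) s (proj₁ ls i)) , least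
      where
      least : (u : N (suc k)) → ((i : I) → Leq (suc k) (approx (suc k) n (d i)) u) →
              Leq (suc k) (approx (suc k) n s) u
      least u h x =
        proj₂ (approx₀-lub n (λ i → proj₁ (d i) (approx k n x)) (proj₁ s (approx k n x))
                 (PW.pointwise d dd s ls (approx k n x)))
              (proj₁ u x) (λ i → h i x)

{-# OPTIONS --safe #-}
module Submission where

-- Cutting a value above m down to ⊥ (instead of to 0, as a ↦ a_m does) at every
-- level gives truncations a⁽ᵐ⁾ that increase with m, stay below a, have lub a, and
-- satisfy a⁽ᵐ⁾ ⊑ a_n for m ≤ n. A compact a lies below some a⁽ᵐ⁾, hence below a_n.

open import Defs
open import Data.Nat using (ℕ; zero; suc; _≤_; _≤?_; _⊔_)
open import Data.Nat.Properties using (≤-refl; ≤-trans; m≤m⊔n; m≤n⊔m)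
open import Data.Product using (Σ-syntax; _×_; _,_; proj₁; proj₂)
open import Data.Empty using (⊥-elim)
open import Function using (_∘_; id)
open import Relation.Nullary using (yes; no)
open import Relation.Binary.PropositionalEquality using (_≡_; refl; sym; subst; subst₂)

Leq-refl : (k : ℕ) (x : N k) → Leq k x x
Leq-refl zero x = ⊑₀-refl x
Leq-refl (suc k) f x = ⊑₀-refl (proj₁ f x)

Leq-trans : (k : ℕ) {x y z : N k} → Leq k x y → Leq k y z → Leq k x z
Leq-trans zero p q = ⊑₀-trans p q
Leq-trans (suc k) p q x = ⊑₀-trans (p x) (q x)

Monotone₀ : (ℕ⊥ → ℕ⊥) → Set₁
Monotone₀ φ = ∀ {x y} → x ⊑₀ y → φ x ⊑₀ φ y

PreservesLubs₀ : (ℕ⊥ → ℕ⊥) → Set₁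
PreservesLubs₀ φ =
  {I : Set} (e : I → ℕ⊥) (t : ℕ⊥) → IsLub _⊑₀_ e t → IsLub _⊑₀_ (φ ∘ e) (φ t)

-- F k is the map on N(k) obtained from φ in the way a ↦ a_n is obtained from approx₀ n.
IsLift : (ℕ⊥ → ℕ⊥) → ((k : ℕ) → N k → N k) → Set₁
IsLift φ F =
  ((x : ℕ⊥) → F zero x ≡ φ x) ×
  ((k : ℕ) (f : N (suc k)) (x : N k) → proj₁ (F (suc k) f) x ≡ φ (proj₁ f (F k x)))

id-isLift : IsLift id (λ _ x → x)
id-isLift = (λ _ → refl) , (λ _ _ _ → refl)

lifts-respect-⊑ : ∀ {φ ψ F G} → IsLift φ F → IsLift ψ G → Monotone₀ φ →
                  ((x : ℕ⊥) → φ x ⊑₀ ψ x) → (k : ℕ) (x : N k) → Leq k (F k x) (G k x)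
lifts-respect-⊑ (F₀ , _) (G₀ , _) _ φ⊑ψ zero x =
  subst₂ _⊑₀_ (sym (F₀ x)) (sym (G₀ x)) (φ⊑ψ x)
lifts-respect-⊑ {F = F} {G} F-lift@(_ , Fₛ) G-lift@(_ , Gₛ) φ-mono φ⊑ψ
                (suc k) (f , f-cont) x =
  subst₂ _⊑₀_ (sym (Fₛ k (f , f-cont) x)) (sym (Gₛ k (f , f-cont) x))
    (⊑₀-trans (φ-mono (proj₁ f-cont (F k x) (G k x) F⊑G)) (φ⊑ψ (f (G k x))))
  where
  F⊑G : Leq k (F k x) (G k x)
  F⊑G = lifts-respect-⊑ F-lift G-lift φ-mono φ⊑ψ k x

truncate₀ : ℕ → ℕ⊥ → ℕ⊥
truncate₀ m ⊥ₙ = ⊥ₙ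
truncate₀ m ⟨ c ⟩ with c ≤? m
... | yes _ = ⟨ c ⟩
... | no _ = ⊥ₙ

truncate₀-mono : (m : ℕ) → Monotone₀ (truncate₀ m)
truncate₀-mono m ⊥⊑ = ⊥⊑
truncate₀-mono m (⟨⟩⊑ {c}) = ⊑₀-refl (truncate₀ m ⟨ c ⟩)

truncate₀-fixes : ∀ {m c} → c ≤ m → truncate₀ m ⟨ c ⟩ ≡ ⟨ c ⟩
truncate₀-fixes {m} {c} c≤m with c ≤? m
... | yes _ = refl
... | no c≰m = ⊥-elim (c≰m c≤m)

approx₀-fixes : ∀ {n c} → c ≤ n → approx₀ n ⟨ c ⟩ ≡ ⟨ c ⟩
approx₀-fixes {n} {c} c≤n with c ≤? n
... | yes _ = refl
... | no c≰n = ⊥-elim (c≰n c≤n)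

truncate₀-⊑ : ∀ {m} (φ : ℕ⊥ → ℕ⊥) → (∀ {c} → c ≤ m → φ ⟨ c ⟩ ≡ ⟨ c ⟩) →
              (x : ℕ⊥) → truncate₀ m x ⊑₀ φ x
truncate₀-⊑ φ fixes ⊥ₙ = ⊥⊑
truncate₀-⊑ {m} φ fixes ⟨ c ⟩ with c ≤? m
... | yes c≤m = subst (⟨ c ⟩ ⊑₀_) (sym (fixes c≤m)) ⟨⟩⊑
... | no _ = ⊥⊑

module Truncation (lem : LEM) where
  open Classical lem

  strict-monotone⇒preservesLubs : ∀ {φ} → φ ⊥ₙ ≡ ⊥ₙ → Monotone₀ φ → PreservesLubs₀ φ
  strict-monotone⇒preservesLubs strict φ-mono e ⊥ₙ (ub , _) =
    (λ i → φ-mono (ub i)) , λ u _ → subst (_⊑₀ u) (sym strict) ⊥⊑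
  strict-monotone⇒preservesLubs {φ} strict φ-mono e ⟨ c ⟩ lub@(ub , _)
    with flat-witness e c lub
  ... | j , ej≡c = (λ i → φ-mono (ub i)) , λ u φe⊑u → subst (λ z → φ z ⊑₀ u) ej≡c (φe⊑u j)

  module Lift (φ : ℕ⊥ → ℕ⊥) (φ-mono : Monotone₀ φ) (φ-lub : PreservesLubs₀ φ) where
    mutual
      lift : (k : ℕ) → N k → N k
      lift zero x = φ x
      lift (suc k) (f , f-cont) = (λ x → φ (f (lift k x))) , mono , lub
        where
        mono : (x y : N k) → Leq k x y → φ (f (lift k x)) ⊑₀ φ (f (lift k y))
        mono x y x⊑y = φ-mono (proj₁ f-cont _ _ (lift-mono k x y x⊑y))

        lub : {I : Set} (d : I → N k) (s : N k) → IsDirected (Leq k) d → IsLub (Leq k) d s →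
              IsLub _⊑₀_ (λ i → φ (f (lift k (d i)))) (φ (f (lift k s)))
        lub d s d-dir s-lub =
          φ-lub (f ∘ lift k ∘ d) (f (lift k s))
            (proj₂ f-cont (lift k ∘ d) (lift k s)
              (dir-map (Leq k) (Leq k) (lift k) (lift-mono k) d-dir)
              (lift-lub k d s d-dir s-lub))

      lift-mono : (k : ℕ) (x y : N k) → Leq k x y → Leq k (lift k x) (lift k y)
      lift-mono zero x y x⊑y = φ-mono x⊑y
      lift-mono (suc k) f g f⊑g x = φ-mono (f⊑g (lift k x))

      lift-lub : (k : ℕ) {I : Set} (d : I → N k) (s : N k) → IsDirected (Leq k) d →
                 IsLub (Leq k) d s → IsLub (Leq k) (lift k ∘ d) (lift k s)
      lift-lub zero d s d-dir s-lub = φ-lub d s s-lub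
      lift-lub (suc k) d s d-dir s-lub@(ub , _) =
        (λ i → lift-mono (suc k) (d i) s (ub i)) ,
        λ u lifts⊑u x →
          proj₂ (φ-lub (λ i → proj₁ (d i) (lift k x)) (proj₁ s (lift k x))
                  (PW.pointwise d d-dir s s-lub (lift k x)))
                (proj₁ u x) (λ i → lifts⊑u i x)

  approx-isLift : (n : ℕ) → IsLift (approx₀ n) (λ k → approx k n)
  approx-isLift n = (λ _ → refl) , (λ _ _ _ → refl)

  truncate : (k m : ℕ) → N k → N k
  truncate k m =
    Lift.lift (truncate₀ m) (truncate₀-mono m)
      (strict-monotone⇒preservesLubs refl (truncate₀-mono m)) k

  truncate-isLift : (m : ℕ) → IsLift (truncate₀ m) (λ k → truncate k m)
  truncate-isLift m = (λ _ → refl) , (λ _ _ _ → refl)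

  truncate-⊑ : (k m : ℕ) (x : N k) → Leq k (truncate k m x) x
  truncate-⊑ k m =
    lifts-respect-⊑ (truncate-isLift m) id-isLift (truncate₀-mono m)
      (truncate₀-⊑ id (λ _ → refl)) k

  truncate-monoʳ : (k : ℕ) {m m′ : ℕ} → m ≤ m′ → (x : N k) →
                   Leq k (truncate k m x) (truncate k m′ x)
  truncate-monoʳ k {m} {m′} m≤m′ =
    lifts-respect-⊑ (truncate-isLift m) (truncate-isLift m′) (truncate₀-mono m)
      (truncate₀-⊑ (truncate₀ m′) (λ c≤m → truncate₀-fixes (≤-trans c≤m m≤m′))) k

  truncate⊑approx : (k : ℕ) {m n : ℕ} → m ≤ n → (x : N k) →
                    Leq k (truncate k m x) (approx k n x)
  truncate⊑approx k {m} {n} m≤n =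
    lifts-respect-⊑ (truncate-isLift m) (approx-isLift n) (truncate₀-mono m)
      (truncate₀-⊑ (approx₀ n) (λ c≤m → approx₀-fixes (≤-trans c≤m m≤n))) k

  truncate-directed : (k : ℕ) (x : N k) → IsDirected (Leq k) (λ m → truncate k m x)
  truncate-directed k x =
    0 , λ i j → i ⊔ j , truncate-monoʳ k (m≤m⊔n i j) x , truncate-monoʳ k (m≤n⊔m i j) x

  mutual
    truncate-isLub : (k : ℕ) (x : N k) → IsLub (Leq k) (λ m → truncate k m x) x
    truncate-isLub k x = (λ m → truncate-⊑ k m x) , truncations-⊑ k x

    truncations-⊑ : (k : ℕ) (x u : N k) → ((m : ℕ) → Leq k (truncate k m x) u) → Leq k x u
    truncations-⊑ zero ⊥ₙ u _ = ⊥⊑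
    truncations-⊑ zero ⟨ c ⟩ u truncations⊑u =
      subst (_⊑₀ u) (truncate₀-fixes ≤-refl) (truncations⊑u c)
    truncations-⊑ (suc k) (f , f-cont) u truncations⊑u y with f y in fy≡c
    ... | ⊥ₙ = ⊥⊑
    ... | ⟨ c ⟩ =
      subst (_⊑₀ proj₁ u y) (truncate₀-fixes (m≤n⊔m j c))
        (subst (λ z → truncate₀ M z ⊑₀ proj₁ u y) fyₘ≡c (truncations⊑u M y))
      where
      hit : Σ[ j ∈ ℕ ] (f (truncate k j y) ≡ ⟨ c ⟩)
      hit = flat-witness (λ m → f (truncate k m y)) c
              (subst (IsLub _⊑₀_ (λ m → f (truncate k m y))) fy≡c
                (proj₂ f-cont (λ m → truncate k m y) y
                  (truncate-directed k y) (truncate-isLub k y)))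

      j : ℕ
      j = proj₁ hit

      M : ℕ
      M = j ⊔ c

      fyₘ≡c : f (truncate k M y) ≡ ⟨ c ⟩
      fyₘ≡c = ⟨⟩⊑-inv (subst (_⊑₀ f (truncate k M y)) (proj₂ hit)
                (proj₁ f-cont _ _ (truncate-monoʳ k (m≤m⊔n j c) y)))

lemma3p12 : (lem : LEM) (k : ℕ) (a : N k) → IsCompact k a →
    Σ[ nₐ ∈ ℕ ] ((n : ℕ) → nₐ ≤ n → Leq k a (Classical.approx lem k n a))
lemma3p12 lem k a compact =
  m , λ n m≤n → Leq-trans k a⊑aᵐ (truncate⊑approx k m≤n a)
  where
  open Truncation lem

  below-truncation : Σ[ m ∈ ℕ ] Leq k a (truncate k m a)
  below-truncation =
    compact (λ m → truncate k m a) a (truncate-directed k a) (truncate-isLub k a) (Leq-refl k a)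

  m : ℕ
  m = proj₁ below-truncation

  a⊑aᵐ : Leq k a (truncate k m a)
  a⊑aᵐ = proj₂ below-truncation
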